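{- Let $\mathcal{A}=\{a_0,\dots,a_{k-1}\}$ be totally ordered and let $p=(p_0,\dots,p_{k-1})$ be a $k$-tuple of non-negative integers. There exists an epichristoffel word $w$ over $\mathcal{A}$ with $|w|_{a_j}=p_j$ for all $0\le j\le k-1$ if and only if iterating the operator $T$ on $p$ yields (after finitely many steps, possibly zero) a $k$-tuple $p'$ with $p'_m=1$ for a unique index $m$ and $p'_j=0$ for all $j\neq m$.
   Context: $|w|_{a}$ denotes the number of occurrences of the letter $a$ in $w$. The operator $T:\mathbb{N}^k\to\mathbb{Z}^k$ is defined by $T(p_0,\dots,p_{k-1})=(p_0,\dots,p_{i-1},\,p_i-\sum_{j\neq i}p_j,\,p_{i+1},\dots,p_{k-1})$ where $i$ is an index with $p_i\ge p_j$ for all $j\neq i$ (the iteration can only be continued while all entries are non-negative). For $a,b\in\mathcal{A}$: $\psi_a(a)=\overline{\psi}_a(a)=a$, $\psi_a(x)=ax$, $\overline{\psi}_a(x)=xa$ for letters $x\neq a$, and $\theta_{ab}$ swaps $a,b$ and fixes other letters; episturmian morphisms are the compositions of these. A word is $c$-epichristoffel if it is the image of a letter under an episturmian morphism; its conjugacy class (the set of words $yx$ with $w=xy$) is an epichristoffel class. An epichristoffel word is the unique Lyndon word (lexicographically smallest word for the given order on $\mathcal{A}$) in an epichristoffel class. -}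

module Defs where

open import Data.Nat using (ℕ; zero; suc; _+_; _∸_; _≤_)
open import Data.Fin using (Fin; _≟_) renaming (_<_ to _<ᶠ_)
open import Data.List using (List; []; _∷_; _++_; [_]; concatMap; map; allFin)
open import Data.Nat.ListAction using (sum)
open import Data.Product using (Σ; ∃; ∃-syntax; _×_; _,_)
open import Relation.Nullary using (¬_; yes; no)
open import Relation.Binary.PropositionalEquality using (_≡_; _≢_)
open import Relation.Binary.Construct.Closure.ReflexiveTransitive using (Star)

-- Alphabet 𝒜 = {a_0,…,a_{k-1}} is Fin k, totally ordered by the order of Fin.
Word : ℕ → Set
Word k = List (Fin k)

∣_∣[_] : ∀ {k} → Word k → Fin k → ℕ
∣ [] ∣[ a ] = 0
∣ x ∷ w ∣[ a ] with x ≟ a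
... | yes _ = suc (∣ w ∣[ a ])
... | no  _ = ∣ w ∣[ a ]

data Gen (k : ℕ) : Set where
  ψ  : Fin k → Gen k
  ψ̄  : Fin k → Gen k
  θ  : Fin k → Fin k → Gen k

genLetter : ∀ {k} → Gen k → Fin k → Word k
genLetter (ψ a) x with x ≟ a
... | yes _ = a ∷ []
... | no  _ = a ∷ x ∷ []
genLetter (ψ̄ a) x with x ≟ a
... | yes _ = a ∷ []
... | no  _ = x ∷ a ∷ []
genLetter (θ a b) x with x ≟ a | x ≟ b
... | yes _ | _     = b ∷ []
... | no  _ | yes _ = a ∷ []
... | no  _ | no  _ = x ∷ []

genWord : ∀ {k} → Gen k → Word k → Word k
genWord g = concatMap (genLetter g)

-- An episturmian morphism, represented as a list of generators
-- [g₁, …, gₙ] standing for the composition g₁ ∘ ⋯ ∘ gₙ (empty list = identity).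
EpiMorphism : ℕ → Set
EpiMorphism k = List (Gen k)

applyEpi : ∀ {k} → EpiMorphism k → Word k → Word k
applyEpi []       w = w
applyEpi (g ∷ gs) w = genWord g (applyEpi gs w)

CEpichristoffel : ∀ {k} → Word k → Set
CEpichristoffel {k} w = Σ (EpiMorphism k) λ f → Σ (Fin k) λ a → applyEpi f (a ∷ []) ≡ w

Conjugate : ∀ {k} → Word k → Word k → Set
Conjugate {k} w u = Σ (Word k) λ x → Σ (Word k) λ y → (w ≡ x ++ y) × (u ≡ y ++ x)

data _≤lex_ {k : ℕ} : Word k → Word k → Set where
  []≤   : ∀ {v} → [] ≤lex v
  here  : ∀ {x y u v} → x <ᶠ y → (x ∷ u) ≤lex (y ∷ v)
  there : ∀ {x u v} → u ≤lex v → (x ∷ u) ≤lex (x ∷ v)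

Epichristoffel : ∀ {k} → Word k → Set
Epichristoffel {k} w =
  Σ (Word k) λ v → CEpichristoffel v × Conjugate v w ×
    ((u : Word k) → Conjugate v u → w ≤lex u)

Tuple : ℕ → Set
Tuple k = Fin k → ℕ

sumOthers : ∀ {k} → Tuple k → Fin k → ℕ
sumOthers {k} p i = sum (map f (allFin k))
  where
  f : Fin k → ℕ
  f j with j ≟ i
  ... | yes _ = 0
  ... | no  _ = p j

-- One application of T (with a chosen maximal index i), allowed only when
-- the result stays non-negative.
data TStep {k : ℕ} (p : Tuple k) (q : Tuple k) : Set where
  tstep : (i : Fin k) →
          (∀ j → j ≢ i → p j ≤ p i) →
          sumOthers p i ≤ p i →
          q i ≡ p i ∸ sumOthers p i →
          (∀ j → j ≢ i → q j ≡ p j) →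
          TStep p q

TReaches : ∀ {k} → Tuple k → Tuple k → Set
TReaches = Star TStep

IsUnitTuple : ∀ {k} → Tuple k → Set
IsUnitTuple {k} p' = Σ (Fin k) λ m → (p' m ≡ 1) × (∀ j → j ≢ m → p' j ≡ 0)

-- The key observation is that the generators ψ_x and ψ̄_x "insert" the letter
-- x: the image of u contains exactly |u| copies of x and the same number of
-- every other letter as u.  Hence the count vector p of ψ_x(u) has p_x = |u| =
-- Σ_j |u|_j, so x is a maximal entry, and one application of T at x returns
-- exactly the count vector of u.  Conversely, if T maps p to q at index i and
-- u has count vector q, then ψ_i(u) has count vector p.
--
-- Since conjugates have the same counts, the theorem follows.
module Submission where

open import Defs
open import Data.Nat using (ℕ)
open import Data.Fin using (Fin)
open import Data.Product using (Σ; _×_)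
open import Function.Bundles using (_⇔_)
open import Relation.Binary.PropositionalEquality using (_≡_)

open import Data.Nat using (zero; suc; _+_; _∸_; _≤_; z≤n; s≤s; s≤s⁻¹)
open import Data.Nat.Properties
  using (+-comm; +-assoc; +-suc; +-identityʳ; m≤m+n; m≤n⇒m≤1+n; m+n∸m≡n; m+[n∸m]≡n; m≤n⇒m<n∨m≡n)
open import Data.Fin using (zero; suc)
open import Data.Fin.Properties using (_≟_; <-cmp; <-trans)
open import Data.List using (List; []; _∷_; _++_; length; map; tabulate; allFin; take; drop)
open import Data.List.Properties using (tabulate-cong; map-tabulate; take++drop≡id; map-++; map-id; map-∘; length-++-≤ˡ)
open import Data.Nat.ListAction using (sum)
open import Data.Product using (_,_; proj₁; proj₂)
open import Data.Sum using (_⊎_; inj₁; inj₂)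
open import Data.Empty using (⊥-elim)
open import Function using (id; _∘_)
open import Function.Bundles using (mk⇔)
open import Function.Definitions using (Injective)
open import Relation.Nullary using (yes; no)
open import Relation.Binary using (tri<; tri≈; tri>)
open import Relation.Binary.PropositionalEquality using (refl; sym; trans; cong; cong₂; subst; subst₂; _≢_; module ≡-Reasoning)
open import Relation.Binary.Construct.Closure.ReflexiveTransitive using (ε; _◅_)

open ≡-Reasoning

cnt : ∀ {k} → Word k → Tuple k
cnt w a = ∣ w ∣[ a ]

cnt-++ : ∀ {k} (x y : Word k) a → ∣ x ++ y ∣[ a ] ≡ ∣ x ∣[ a ] + ∣ y ∣[ a ]
cnt-++ []      y a = refl
cnt-++ (z ∷ x) y a with z ≟ a
... | yes _ = cong suc (cnt-++ x y a)
... | no  _ = cnt-++ x y a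

cnt-self : ∀ {k} (x : Fin k) (w : Word k) → ∣ x ∷ w ∣[ x ] ≡ suc ∣ w ∣[ x ]
cnt-self x w with x ≟ x
... | yes _   = refl
... | no  x≢x = ⊥-elim (x≢x refl)

cnt-other : ∀ {k} {x a : Fin k} (w : Word k) → x ≢ a → ∣ x ∷ w ∣[ a ] ≡ ∣ w ∣[ a ]
cnt-other {x = x} {a} w x≢a with x ≟ a
... | yes x≡a = ⊥-elim (x≢a x≡a)
... | no  _   = refl

cnt≤length : ∀ {k} (w : Word k) a → ∣ w ∣[ a ] ≤ length w
cnt≤length []      a = z≤n
cnt≤length (x ∷ w) a with x ≟ a
... | yes _ = s≤s (cnt≤length w a)
... | no  _ = m≤n⇒m≤1+n (cnt≤length w a)

conjugate-cnt : ∀ {k} {v w : Word k} → Conjugate v w → ∀ j → ∣ w ∣[ j ] ≡ ∣ v ∣[ j ]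
conjugate-cnt (x , y , refl , refl) j = begin
  ∣ y ++ x ∣[ j ]            ≡⟨ cnt-++ y x j ⟩
  ∣ y ∣[ j ] + ∣ x ∣[ j ]    ≡⟨ +-comm ∣ y ∣[ j ] ∣ x ∣[ j ] ⟩
  ∣ x ∣[ j ] + ∣ y ∣[ j ]    ≡⟨ sym (cnt-++ x y j) ⟩
  ∣ x ++ y ∣[ j ]            ∎

total : ∀ {k} → Tuple k → ℕ
total p = sum (tabulate p)

erase : ∀ {k} → Tuple k → Fin k → Tuple k
erase p i j with j ≟ i
... | yes _ = 0
... | no  _ = p j

-- sumOthers sums an anonymous summand over allFin k; exposing it lets us
-- compare it pointwise with erase.
sumOthers-summand : ∀ {k} (p : Tuple k) i → Σ (Fin k → ℕ) λ F → sumOthers p i ≡ sum (map F (allFin k))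
sumOthers-summand p i = _ , refl

summand-is-erase : ∀ {k} (p : Tuple k) i j → proj₁ (sumOthers-summand p i) j ≡ erase p i j
summand-is-erase p i j with j ≟ i
... | yes _ = refl
... | no  _ = refl

sumOthers-erase : ∀ {k} (p : Tuple k) i → sumOthers p i ≡ total (erase p i)
sumOthers-erase {k} p i = begin
  sumOthers p i           ≡⟨ proj₂ (sumOthers-summand p i) ⟩
  sum (map F (allFin k))  ≡⟨ cong sum (map-tabulate id F) ⟩
  sum (tabulate F)        ≡⟨ cong sum (tabulate-cong (summand-is-erase p i)) ⟩
  total (erase p i)       ∎
  where
  F : Fin k → ℕ
  F = proj₁ (sumOthers-summand p i)

erase-suc : ∀ {k} (p : Tuple (suc k)) i j → erase p (suc i) (suc j) ≡ erase (p ∘ suc) i j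
erase-suc p i j with j ≟ i
... | yes _ = refl
... | no  _ = refl

total-erase : ∀ {k} (p : Tuple k) i → total (erase p i) + p i ≡ total p
total-erase p zero = +-comm _ (p zero)
total-erase p (suc i) = begin
  (p zero + total (erase p (suc i) ∘ suc)) + p (suc i)
    ≡⟨ cong (λ t → (p zero + t) + p (suc i)) (cong sum (tabulate-cong (erase-suc p i))) ⟩
  (p zero + total (erase (p ∘ suc) i)) + p (suc i)
    ≡⟨ +-assoc (p zero) _ _ ⟩
  p zero + (total (erase (p ∘ suc) i) + p (suc i))
    ≡⟨ cong (p zero +_) (total-erase (p ∘ suc) i) ⟩
  p zero + total (p ∘ suc)
    ∎

sumOthers-split : ∀ {k} (p : Tuple k) i → sumOthers p i + p i ≡ total p
sumOthers-split p i = trans (cong (_+ p i) (sumOthers-erase p i)) (total-erase p i)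

sumOthers-cong : ∀ {k} (p q : Tuple k) i → (∀ j → j ≢ i → p j ≡ q j) → sumOthers p i ≡ sumOthers q i
sumOthers-cong p q i agree = begin
  sumOthers p i      ≡⟨ sumOthers-erase p i ⟩
  total (erase p i)  ≡⟨ cong sum (tabulate-cong erase-agree) ⟩
  total (erase q i)  ≡⟨ sym (sumOthers-erase q i) ⟩
  sumOthers q i      ∎
  where
  erase-agree : ∀ j → erase p i j ≡ erase q i j
  erase-agree j with j ≟ i
  ... | yes _   = refl
  ... | no  j≢i = agree j j≢i

total-zero : ∀ k → total {k} (λ _ → 0) ≡ 0
total-zero zero    = refl
total-zero (suc k) = total-zero k

total-cnt : ∀ {k} (w : Word k) → total (cnt w) ≡ length w
total-cnt {k} []    = total-zero k
total-cnt (y ∷ w) = begin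
  total (cnt (y ∷ w))                      ≡⟨ sym (sumOthers-split (cnt (y ∷ w)) y) ⟩
  sumOthers (cnt (y ∷ w)) y + ∣ y ∷ w ∣[ y ]
    ≡⟨ cong₂ _+_ (sumOthers-cong _ _ y (λ j j≢y → cnt-other w (j≢y ∘ sym))) (cnt-self y w) ⟩
  sumOthers (cnt w) y + suc ∣ w ∣[ y ]     ≡⟨ +-suc _ _ ⟩
  suc (sumOthers (cnt w) y + ∣ w ∣[ y ])   ≡⟨ cong suc (sumOthers-split (cnt w) y) ⟩
  suc (total (cnt w))                      ≡⟨ cong suc (total-cnt w) ⟩
  suc (length w)                           ∎

sumOthers-cnt : ∀ {k} (u : Word k) i → sumOthers (cnt u) i + ∣ u ∣[ i ] ≡ length u
sumOthers-cnt u i = trans (sumOthers-split (cnt u) i) (total-cnt u)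

record Inserts {k} (G : Gen k) (x : Fin k) : Set where
  field
    once  : ∀ y → ∣ genLetter G y ∣[ x ] ≡ 1
    keeps : ∀ y j → j ≢ x → ∣ genLetter G y ∣[ j ] ≡ ∣ y ∷ [] ∣[ j ]

ψ-inserts : ∀ {k} (x : Fin k) → Inserts (ψ x) x
ψ-inserts x = record { once = once ; keeps = keeps }
  where
  once : ∀ y → ∣ genLetter (ψ x) y ∣[ x ] ≡ 1
  once y with y ≟ x
  ... | yes _   = cnt-self x []
  ... | no  y≢x = trans (cnt-self x (y ∷ [])) (cong suc (cnt-other [] y≢x))
  keeps : ∀ y j → j ≢ x → ∣ genLetter (ψ x) y ∣[ j ] ≡ ∣ y ∷ [] ∣[ j ]
  keeps y j j≢x with y ≟ x
  ... | yes refl = refl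
  ... | no  _    = cnt-other (y ∷ []) (j≢x ∘ sym)

ψ̄-inserts : ∀ {k} (x : Fin k) → Inserts (ψ̄ x) x
ψ̄-inserts x = record { once = once ; keeps = keeps }
  where
  once : ∀ y → ∣ genLetter (ψ̄ x) y ∣[ x ] ≡ 1
  once y with y ≟ x
  ... | yes _   = cnt-self x []
  ... | no  y≢x = trans (cnt-other (x ∷ []) y≢x) (cnt-self x [])
  keeps : ∀ y j → j ≢ x → ∣ genLetter (ψ̄ x) y ∣[ j ] ≡ ∣ y ∷ [] ∣[ j ]
  keeps y j j≢x with y ≟ x
  ... | yes refl = refl
  ... | no  _    = begin
    ∣ y ∷ x ∷ [] ∣[ j ]                 ≡⟨ cnt-++ (y ∷ []) (x ∷ []) j ⟩
    ∣ y ∷ [] ∣[ j ] + ∣ x ∷ [] ∣[ j ]   ≡⟨ cong (∣ y ∷ [] ∣[ j ] +_) (cnt-other [] (j≢x ∘ sym)) ⟩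
    ∣ y ∷ [] ∣[ j ] + 0                 ≡⟨ +-identityʳ _ ⟩
    ∣ y ∷ [] ∣[ j ]                     ∎

module _ {k} {G : Gen k} {x : Fin k} (ins : Inserts G x) where
  open Inserts ins

  insertion-count : ∀ u → ∣ genWord G u ∣[ x ] ≡ length u
  insertion-count []      = refl
  insertion-count (y ∷ u) =
    trans (cnt-++ (genLetter G y) (genWord G u) x) (cong₂ _+_ (once y) (insertion-count u))

  insertion-keeps : ∀ u j → j ≢ x → ∣ genWord G u ∣[ j ] ≡ ∣ u ∣[ j ]
  insertion-keeps []      j j≢x = refl
  insertion-keeps (y ∷ u) j j≢x = begin
    ∣ genLetter G y ++ genWord G u ∣[ j ]         ≡⟨ cnt-++ (genLetter G y) (genWord G u) j ⟩
    ∣ genLetter G y ∣[ j ] + ∣ genWord G u ∣[ j ]  ≡⟨ cong₂ _+_ (keeps y j j≢x) (insertion-keeps u j j≢x) ⟩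
    ∣ y ∷ [] ∣[ j ] + ∣ u ∣[ j ]                  ≡⟨ sym (cnt-++ (y ∷ []) u j) ⟩
    ∣ y ∷ u ∣[ j ]                                ∎

  -- One T-step at x undoes an x-insertion on the level of counts: x is a
  -- maximal entry of cnt (G u) and its excess over the others is |u|_x.
  T-undoes-insertion : ∀ u → TStep (cnt (genWord G u)) (cnt u)
  T-undoes-insertion u = tstep x maximal fits result (λ j j≢x → sym (insertion-keeps u j j≢x))
    where
    rest : sumOthers (cnt (genWord G u)) x ≡ sumOthers (cnt u) x
    rest = sumOthers-cong _ _ x (insertion-keeps u)
    maximal : ∀ j → j ≢ x → ∣ genWord G u ∣[ j ] ≤ ∣ genWord G u ∣[ x ]
    maximal j j≢x = subst₂ _≤_ (sym (insertion-keeps u j j≢x)) (sym (insertion-count u)) (cnt≤length u j)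
    fits : sumOthers (cnt (genWord G u)) x ≤ ∣ genWord G u ∣[ x ]
    fits = subst₂ _≤_ (sym rest) (trans (sumOthers-cnt u x) (sym (insertion-count u))) (m≤m+n _ _)
    result : ∣ u ∣[ x ] ≡ ∣ genWord G u ∣[ x ] ∸ sumOthers (cnt (genWord G u)) x
    result = begin
      ∣ u ∣[ x ]                                          ≡⟨ sym (m+n∸m≡n (sumOthers (cnt u) x) _) ⟩
      (sumOthers (cnt u) x + ∣ u ∣[ x ]) ∸ sumOthers (cnt u) x
        ≡⟨ cong₂ _∸_ (trans (sumOthers-cnt u x) (sym (insertion-count u))) (sym rest) ⟩
      ∣ genWord G u ∣[ x ] ∸ sumOthers (cnt (genWord G u)) x ∎

T-step-lift : ∀ {k} {p q : Tuple k} → TStep p q → (u : Word k) → (∀ j → ∣ u ∣[ j ] ≡ q j) →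
  Σ (Fin k) λ i → ∀ j → ∣ genWord (ψ i) u ∣[ j ] ≡ p j
T-step-lift {p = p} (tstep i _ fits qi q-others) u counts = i , lifted
  where
  rest : sumOthers (cnt u) i ≡ sumOthers p i
  rest = sumOthers-cong (cnt u) p i (λ j j≢i → trans (counts j) (q-others j j≢i))
  lifted : ∀ j → ∣ genWord (ψ i) u ∣[ j ] ≡ p j
  lifted j with j ≟ i
  ... | yes refl = begin
    ∣ genWord (ψ i) u ∣[ i ]                   ≡⟨ insertion-count (ψ-inserts i) u ⟩
    length u                                   ≡⟨ sym (sumOthers-cnt u i) ⟩
    sumOthers (cnt u) i + ∣ u ∣[ i ]           ≡⟨ cong₂ _+_ rest (trans (counts i) qi) ⟩
    sumOthers p i + (p i ∸ sumOthers p i)      ≡⟨ m+[n∸m]≡n fits ⟩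
    p i                                        ∎
  ... | no j≢i = trans (insertion-keeps (ψ-inserts i) u j j≢i) (trans (counts j) (q-others j j≢i))

ReachesUnit : ∀ {k} → Tuple k → Set
ReachesUnit {k} p = Σ (Tuple k) λ p' → TReaches p p' × IsUnitTuple p'

ReachesUnit-resp : ∀ {k} {p q : Tuple k} → (∀ j → p j ≡ q j) → ReachesUnit p → ReachesUnit q
ReachesUnit-resp {q = q} p≗q (_ , ε , (m , pm , p-others)) =
  q , ε , (m , trans (sym (p≗q m)) pm , λ j j≢m → trans (sym (p≗q j)) (p-others j j≢m))
ReachesUnit-resp {p = p} {q} p≗q (p' , (tstep i max fits qi q-others ◅ path) , unit) =
  p' , (tstep i max' fits' (trans qi (cong₂ _∸_ (p≗q i) rest)) (λ j j≢i → trans (q-others j j≢i) (p≗q j)) ◅ path) , unit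
  where
  rest : sumOthers p i ≡ sumOthers q i
  rest = sumOthers-cong p q i (λ j _ → p≗q j)
  max' : ∀ j → j ≢ i → q j ≤ q i
  max' j j≢i = subst₂ _≤_ (p≗q j) (p≗q i) (max j j≢i)
  fits' : sumOthers q i ≤ q i
  fits' = subst₂ _≤_ rest (p≗q i) fits

peel-insertion : ∀ {k} {G : Gen k} {x : Fin k} {w : Word k} (v : Word k) →
  Inserts G x → w ≡ genWord G v → ReachesUnit (cnt v) → ReachesUnit (cnt w)
peel-insertion v ins refl (p' , path , unit) = p' , (T-undoes-insertion ins v ◅ path) , unit

rename-word : ∀ {k} (r : Fin k → Fin k) (G G' : Gen k) →
  (∀ y → map r (genLetter G y) ≡ genLetter G' (r y)) →
  ∀ u → map r (genWord G u) ≡ genWord G' (map r u)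
rename-word r G G' letter []      = refl
rename-word r G G' letter (y ∷ u) =
  trans (map-++ r (genLetter G y) (genWord G u)) (cong₂ _++_ (letter y) (rename-word r G G' letter u))

-- r ∘ ψ_x = ψ_{r x} ∘ r letterwise; injectivity of r keeps x and y ≠ x apart.
rename-ψ : ∀ {k} (r : Fin k → Fin k) → Injective _≡_ _≡_ r →
  ∀ x y → map r (genLetter (ψ x) y) ≡ genLetter (ψ (r x)) (r y)
rename-ψ r r-inj x y with y ≟ x | r y ≟ r x
... | yes _   | yes _    = refl
... | yes y≡x | no  ry≢  = ⊥-elim (ry≢ (cong r y≡x))
... | no  y≢x | yes ry≡  = ⊥-elim (y≢x (r-inj ry≡))
... | no  _   | no  _    = refl

rename-ψ̄ : ∀ {k} (r : Fin k → Fin k) → Injective _≡_ _≡_ r →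
  ∀ x y → map r (genLetter (ψ̄ x) y) ≡ genLetter (ψ̄ (r x)) (r y)
rename-ψ̄ r r-inj x y with y ≟ x | r y ≟ r x
... | yes _   | yes _    = refl
... | yes y≡x | no  ry≢  = ⊥-elim (ry≢ (cong r y≡x))
... | no  y≢x | yes ry≡  = ⊥-elim (y≢x (r-inj ry≡))
... | no  _   | no  _    = refl

transpose : ∀ {k} → Fin k → Fin k → Fin k → Fin k
transpose a b x with x ≟ a | x ≟ b
... | yes _ | _     = b
... | no  _ | yes _ = a
... | no  _ | no  _ = x

θ-word : ∀ {k} (a b : Fin k) u → genWord (θ a b) u ≡ map (transpose a b) u
θ-word a b []      = refl
θ-word a b (y ∷ u) = cong₂ _++_ letter (θ-word a b u)
  where
  letter : genLetter (θ a b) y ≡ transpose a b y ∷ []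
  letter with y ≟ a | y ≟ b
  ... | yes _ | _     = refl
  ... | no  _ | yes _ = refl
  ... | no  _ | no  _ = refl

transpose-a : ∀ {k} (a b : Fin k) → transpose a b a ≡ b
transpose-a a b with a ≟ a
... | yes _   = refl
... | no  a≢a = ⊥-elim (a≢a refl)

transpose-b : ∀ {k} (a b : Fin k) → transpose a b b ≡ a
transpose-b a b with b ≟ a | b ≟ b
... | yes b≡a | _       = b≡a
... | no  _   | yes _   = refl
... | no  _   | no  b≢b = ⊥-elim (b≢b refl)

transpose-other : ∀ {k} (a b x : Fin k) → x ≢ a → x ≢ b → transpose a b x ≡ x
transpose-other a b x x≢a x≢b with x ≟ a | x ≟ b
... | yes x≡a | _       = ⊥-elim (x≢a x≡a)
... | no  _   | yes x≡b = ⊥-elim (x≢b x≡b)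
... | no  _   | no  _   = refl

transpose-involutive : ∀ {k} (a b x : Fin k) → transpose a b (transpose a b x) ≡ x
transpose-involutive a b x with x ≟ a | x ≟ b
... | yes refl | _        = transpose-b x b
... | no  _    | yes refl = transpose-a a x
... | no  x≢a  | no  x≢b  = transpose-other a b x x≢a x≢b

transpose-injective : ∀ {k} (a b : Fin k) → Injective _≡_ _≡_ (transpose a b)
transpose-injective a b {x} {y} t≡ = begin
  x                                    ≡⟨ sym (transpose-involutive a b x) ⟩
  transpose a b (transpose a b x)      ≡⟨ cong (transpose a b) t≡ ⟩
  transpose a b (transpose a b y)      ≡⟨ transpose-involutive a b y ⟩
  y                                    ∎

letter-unit : ∀ {k} (m : Fin k) → IsUnitTuple (cnt (m ∷ []))
letter-unit m = m , cnt-self m [] , λ j j≢m → cnt-other [] (j≢m ∘ sym)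

-- Forward direction, generalised over injective renamings so that the
-- letter permutations θ_ab can be absorbed into the renaming.
renamed-cEpichristoffel-reaches : ∀ {k} (f : EpiMorphism k) (a : Fin k) (r : Fin k → Fin k) →
  Injective _≡_ _≡_ r → ReachesUnit (cnt (map r (applyEpi f (a ∷ []))))
renamed-cEpichristoffel-reaches []          a r r-inj = cnt (r a ∷ []) , ε , letter-unit (r a)
renamed-cEpichristoffel-reaches (ψ x ∷ f)   a r r-inj =
  peel-insertion (map r (applyEpi f (a ∷ []))) (ψ-inserts (r x))
    (rename-word r (ψ x) (ψ (r x)) (rename-ψ r r-inj x) (applyEpi f (a ∷ [])))
    (renamed-cEpichristoffel-reaches f a r r-inj)
renamed-cEpichristoffel-reaches (ψ̄ x ∷ f)   a r r-inj =
  peel-insertion (map r (applyEpi f (a ∷ []))) (ψ̄-inserts (r x))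
    (rename-word r (ψ̄ x) (ψ̄ (r x)) (rename-ψ̄ r r-inj x) (applyEpi f (a ∷ [])))
    (renamed-cEpichristoffel-reaches f a r r-inj)
renamed-cEpichristoffel-reaches (θ b c ∷ f) a r r-inj =
  subst (ReachesUnit ∘ cnt) (sym absorb)
    (renamed-cEpichristoffel-reaches f a (r ∘ transpose b c) (transpose-injective b c ∘ r-inj))
  where
  u : Word _
  u = applyEpi f (a ∷ [])
  absorb : map r (genWord (θ b c) u) ≡ map (r ∘ transpose b c) u
  absorb = trans (cong (map r) (θ-word b c u)) (sym (map-∘ u))

cEpichristoffel-reaches : ∀ {k} {v : Word k} → CEpichristoffel v → ReachesUnit (cnt v)
cEpichristoffel-reaches (f , a , f[a]≡v) =
  subst (ReachesUnit ∘ cnt) (trans (map-id _) f[a]≡v) (renamed-cEpichristoffel-reaches f a id id)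

-- Backward direction: read a T-path to a unit tuple backwards as ψ's applied
-- to the letter marked by the unit tuple.
reaches-cEpichristoffel : ∀ {k} {p p' : Tuple k} → TReaches p p' → IsUnitTuple p' →
  Σ (Word k) λ v → CEpichristoffel v × (∀ j → ∣ v ∣[ j ] ≡ p j)
reaches-cEpichristoffel {p = p} ε (m , pm , p-others) = m ∷ [] , ([] , m , refl) , counts
  where
  counts : ∀ j → ∣ m ∷ [] ∣[ j ] ≡ p j
  counts j with j ≟ m
  ... | yes refl = trans (cnt-self m []) (sym pm)
  ... | no  j≢m  = trans (cnt-other [] (j≢m ∘ sym)) (sym (p-others j j≢m))
reaches-cEpichristoffel (step ◅ path) unit with reaches-cEpichristoffel path unit
... | u , (f , a , f[a]≡u) , counts with T-step-lift step u counts
...   | i , lifted = genWord (ψ i) u , (ψ i ∷ f , a , cong (genWord (ψ i)) f[a]≡u) , lifted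

≤lex-refl : ∀ {k} (u : Word k) → u ≤lex u
≤lex-refl []      = []≤
≤lex-refl (x ∷ u) = there (≤lex-refl u)

≤lex-trans : ∀ {k} {u v w : Word k} → u ≤lex v → v ≤lex w → u ≤lex w
≤lex-trans []≤       _         = []≤
≤lex-trans (here p)  (here q)  = here (<-trans p q)
≤lex-trans (here p)  (there _) = here p
≤lex-trans (there _) (here q)  = here q
≤lex-trans (there p) (there q) = there (≤lex-trans p q)

≤lex-total : ∀ {k} (u v : Word k) → u ≤lex v ⊎ v ≤lex u
≤lex-total []      v       = inj₁ []≤
≤lex-total (x ∷ u) []      = inj₂ []≤
≤lex-total (x ∷ u) (y ∷ v) with <-cmp x y
... | tri< x<y _ _ = inj₁ (here x<y)
... | tri> _ _ y<x = inj₂ (here y<x)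
... | tri≈ _ refl _ with ≤lex-total u v
...   | inj₁ u≤v = inj₁ (there u≤v)
...   | inj₂ v≤u = inj₂ (there v≤u)

rotation : ∀ {k} → Word k → ℕ → Word k
rotation v n = drop n v ++ take n v

rotation-conjugate : ∀ {k} (v : Word k) n → Conjugate v (rotation v n)
rotation-conjugate v n = take n v , drop n v , sym (take++drop≡id n v) , refl

take-prefix : ∀ {k} (x y : Word k) → take (length x) (x ++ y) ≡ x
take-prefix []      y = refl
take-prefix (a ∷ x) y = cong (a ∷_) (take-prefix x y)

drop-prefix : ∀ {k} (x y : Word k) → drop (length x) (x ++ y) ≡ y
drop-prefix []      y = refl
drop-prefix (a ∷ x) y = drop-prefix x y

conjugate-rotation : ∀ {k} {v u : Word k} → Conjugate v u → Σ ℕ λ n → n ≤ length v × u ≡ rotation v n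
conjugate-rotation (x , y , refl , refl) =
  length x , length-++-≤ˡ x , sym (cong₂ _++_ (drop-prefix x y) (take-prefix x y))

least-rotation : ∀ {k} (v : Word k) n →
  Σ (Word k) λ w → Conjugate v w × (∀ m → m ≤ n → w ≤lex rotation v m)
least-rotation v zero = rotation v 0 , rotation-conjugate v 0 , λ { _ z≤n → ≤lex-refl _ }
least-rotation v (suc n) with least-rotation v n
... | w , v~w , least = pick (≤lex-total w r)
  where
  r : Word _
  r = rotation v (suc n)
  pick : w ≤lex r ⊎ r ≤lex w → Σ (Word _) λ w' → Conjugate v w' × (∀ m → m ≤ suc n → w' ≤lex rotation v m)
  pick (inj₁ w≤r) = w , v~w , bound
    where
    bound : ∀ m → m ≤ suc n → w ≤lex rotation v m
    bound m m≤ with m≤n⇒m<n∨m≡n m≤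
    ... | inj₁ m<   = least m (s≤s⁻¹ m<)
    ... | inj₂ refl = w≤r
  pick (inj₂ r≤w) = r , rotation-conjugate v (suc n) , bound
    where
    bound : ∀ m → m ≤ suc n → r ≤lex rotation v m
    bound m m≤ with m≤n⇒m<n∨m≡n m≤
    ... | inj₁ m<   = ≤lex-trans r≤w (least m (s≤s⁻¹ m<))
    ... | inj₂ refl = ≤lex-refl r

least-conjugate : ∀ {k} (v : Word k) → Σ (Word k) λ w → Conjugate v w × (∀ u → Conjugate v u → w ≤lex u)
least-conjugate v with least-rotation v (length v)
... | w , v~w , least = w , v~w , minimal
  where
  minimal : ∀ u → Conjugate v u → w ≤lex u
  minimal u v~u with conjugate-rotation v~u
  ... | n , n≤ , refl = least n n≤

proposition5p2 : (k : ℕ) (p : Tuple k) →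
    (Σ (Word k) (λ w → Epichristoffel w × ((j : Fin k) → ∣ w ∣[ j ] ≡ p j)))
    ⇔ Σ (Tuple k) (λ p' → TReaches p p' × IsUnitTuple p')
proposition5p2 k p = mk⇔ counts-reach reach-counts
  where
  counts-reach : Σ (Word k) (λ w → Epichristoffel w × ((j : Fin k) → ∣ w ∣[ j ] ≡ p j)) → ReachesUnit p
  counts-reach (w , (v , cv , v~w , _) , counts) =
    ReachesUnit-resp (λ j → trans (sym (conjugate-cnt v~w j)) (counts j)) (cEpichristoffel-reaches cv)
  reach-counts : ReachesUnit p → Σ (Word k) (λ w → Epichristoffel w × ((j : Fin k) → ∣ w ∣[ j ] ≡ p j))
  reach-counts (p' , path , unit) with reaches-cEpichristoffel path unit
  ... | v , cv , counts with least-conjugate v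
  ...   | w , v~w , least = w , (v , cv , v~w , least) , λ j → trans (conjugate-cnt v~w j) (counts j)
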